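{- Let $n$ be even and let $X = \mathrm{Cay}(\mathbb{Z}_n, S)$ be a circulant graph. Suppose there exist permutations $\alpha$ and $\beta$ of $2\mathbb{Z}_n$ and a subgroup $H$ of $2\mathbb{Z}_n$ such that: (1) $\alpha \neq \beta$; (2) whenever vertices $u, v \in 2\mathbb{Z}_n$ are adjacent in $X$, the vertices $\alpha(u)$ and $\beta(v)$ are adjacent in $X$; (3) $s + H \subseteq S$ for every odd $s \in S$ (i.e., every $s \in S \setminus 2\mathbb{Z}_n$); and (4) $\alpha(v) - v \in H$ and $\beta(v) - v \in H$ for all $v \in 2\mathbb{Z}_n$. Then $X$ is unstable.
   Context: All graphs are finite, simple and undirected. For an abelian group $G$ and $S \subseteq G$ with $-S = S$, $0 \notin S$, $\mathrm{Cay}(G,S)$ has vertex set $G$ with $v \sim w$ iff $w - v \in S$. The canonical bipartite double cover $BX$ of $X$ has vertex set $V(X) \times \{0,1\}$, with $(v,0)$ adjacent to $(w,1)$ iff $v \sim w$ in $X$. $\mathrm{Aut}\,X \times S_2$ embeds in $\mathrm{Aut}\,BX$ via $(\varphi,\sigma)(v,i) = (\varphi(v),\sigma(i))$. $X$ is unstable if $\mathrm{Aut}\,BX \neq \mathrm{Aut}\,X \times S_2$. -}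

module Defs where

open import Data.Nat using (ℕ; NonZero; _∸_)
import Data.Nat as ℕ
open import Data.Nat.DivMod using (_%_; m%n<n)
open import Data.Nat.Divisibility using (_∣_)
open import Data.Fin using (Fin; toℕ; fromℕ<; zero)
open import Data.Fin.Subset using (Subset; _∈_; _∉_)
open import Data.Bool using (Bool)
open import Data.Product using (Σ; ∃; _×_; _,_; proj₁; proj₂)
open import Function.Bundles using (_↔_; Inverse)
open import Relation.Nullary using (¬_)
open import Relation.Binary.PropositionalEquality using (_≡_; _≢_)

module _ {n : ℕ} .{{_ : NonZero n}} where

  _⊕_ : Fin n → Fin n → Fin n
  a ⊕ b = fromℕ< (m%n<n (toℕ a ℕ.+ toℕ b) n)

  ⊖_ : Fin n → Fin n
  ⊖ a = fromℕ< (m%n<n (n ∸ toℕ a) n)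

  _⊝_ : Fin n → Fin n → Fin n
  a ⊝ b = a ⊕ (⊖ b)

  zeroₙ : Fin n
  zeroₙ = fromℕ< (m%n<n 0 n)

-- x ∈ 2ℤ_n (well defined as residue parity since n is even)
IsEven : {n : ℕ} → Fin n → Set
IsEven x = 2 ∣ toℕ x

Even : ℕ → Set
Even n = Σ (Fin n) IsEven

IsConnectionSet : (n : ℕ) .{{_ : NonZero n}} → Subset n → Set
IsConnectionSet n S = (∀ s → s ∈ S → (⊖ s) ∈ S) × (zeroₙ ∉ S)

Adj : {n : ℕ} .{{_ : NonZero n}} → Subset n → Fin n → Fin n → Set
Adj S v w = (w ⊝ v) ∈ S

IsSubgroupOf2ℤ : (n : ℕ) .{{_ : NonZero n}} → Subset n → Set
IsSubgroupOf2ℤ n H =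
  (∀ h → h ∈ H → IsEven h) × (zeroₙ ∈ H) ×
  (∀ a b → a ∈ H → b ∈ H → (a ⊕ b) ∈ H) × (∀ a → a ∈ H → (⊖ a) ∈ H)

IsAut : {V : Set} → (V → V → Set) → V ↔ V → Set
IsAut {V} R φ = ∀ x y → (R x y → R (f x) (f y)) × (R (f x) (f y) → R x y)
  where f = Inverse.to φ

-- Canonical bipartite double cover BX: (v,i) ∼ (w,j) iff i ≠ j and v ∼ w
AdjB : {n : ℕ} .{{_ : NonZero n}} → Subset n → Fin n × Bool → Fin n × Bool → Set
AdjB S (v , i) (w , j) = (i ≢ j) × Adj S v w

InAutX×S₂ : {n : ℕ} .{{_ : NonZero n}} → Subset n → (Fin n × Bool) ↔ (Fin n × Bool) → Set
InAutX×S₂ {n} S φ =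
  Σ (Fin n ↔ Fin n) λ ψ → Σ (Bool ↔ Bool) λ σ → IsAut (Adj S) ψ ×
    (∀ v i → Inverse.to φ (v , i) ≡ (Inverse.to ψ v , Inverse.to σ i))

-- X = Cay(ℤ_n, S) is unstable: Aut BX ≠ Aut X × S₂
Unstable : (n : ℕ) .{{_ : NonZero n}} → Subset n → Set
Unstable n S =
  Σ ((Fin n × Bool) ↔ (Fin n × Bool)) λ φ → IsAut (AdjB S) φ × ¬ InAutX×S₂ S φ

-- Let α̂ and β̂ extend α and β by the identity on the odd residues, and let φ act as α̂ on the
-- sheet V × {0} of BX and as β̂ on V × {1}.  An edge between two even vertices is preserved
-- by (2), and reflected because (u , v) ↦ (α u , β v) permutes a finite set, so some iterate
-- of it fixes (u , v).  An edge between an even x and an odd y is sent to one between x + h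
-- and y with h ∈ H by (4); since y − x is odd, (3) applied to h and −h gives
-- y − x ∈ S ⇔ y − x − h ∈ S.  Edges between odd vertices are untouched.  As α ≠ β, φ moves
-- some vertex differently on the two sheets, so it is not of the form ψ × σ.
module Submission where

open import Defs
open import Data.Nat using (ℕ; NonZero)
open import Data.Nat.Divisibility using (_∣_)
open import Data.Fin using (Fin)
open import Data.Fin.Subset using (Subset; _∈_)
open import Data.Product using (_×_; proj₁)
open import Function.Bundles using (_↔_; Inverse)
open import Relation.Nullary using (¬_)
open import Relation.Binary.PropositionalEquality using (_≡_)

open import Algebra.Bundles using (AbelianGroup)
open import Algebra.Structures using (IsAbelianGroup)
open import Data.Bool using (Bool; true; false)
open import Data.Empty using (⊥-elim)
open import Data.Fin using (toℕ; combine)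
open import Data.Fin.Properties using (toℕ-injective; toℕ-fromℕ<; toℕ<n; toℕ≤n; pigeonhole; combine-injective)
open import Data.Nat using (suc; zero; _+_; _∸_; _%_)
open import Data.Nat.DivMod using (%-distribˡ-+; m%n%n≡m%n; m*n%n≡0; m<n⇒m%n≡m; n%n≡0)
open import Data.Nat.Divisibility using (divides; _∣?_; ∣m∣n⇒∣m+n; %-presˡ-∣)
open import Data.Nat.GeneralisedArithmetic using (iterate)
open import Data.Nat.Properties using (+-comm; +-assoc; +-identityʳ; m+[n∸m]≡n; ≡-irrelevant; *-cancelʳ-≡; n<1+n; m≤n⇒∃[o]m+o≡n)
open import Data.Product using (Σ; _,_; proj₂; map)
open import Function.Base using (_∘_)
open import Function.Bundles using (_⇔_; mk⇔; Equivalence; Injection; mk↔ₛ′)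
open import Function.Properties.Inverse using (↔⇒↣)
open import Function.Definitions using (Injective)
import Function.Properties.Equivalence as ⇔
open import Relation.Binary.PropositionalEquality using (_≢_; refl; sym; trans; cong; cong₂; subst; isEquivalence; module ≡-Reasoning)
open import Relation.Nullary using (Dec; yes; no; Irrelevant)
open import Relation.Nullary.Decidable using (dec-yes-irr; dec-no)
import Algebra.Properties.AbelianGroup as AbelianGroupProperties

∣-irrelevant : ∀ {d m} .{{_ : NonZero d}} → Irrelevant (d ∣ m)
∣-irrelevant {d} (divides p eq) (divides q eq′) with *-cancelʳ-≡ p q d (trans (sym eq) eq′)
... | refl = cong (divides p) (≡-irrelevant eq eq′)

module _ {n : ℕ} .{{_ : NonZero n}} where

  toℕ-⊕ : ∀ a b → toℕ (a ⊕ b) ≡ (toℕ a + toℕ b) % n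
  toℕ-⊕ a b = toℕ-fromℕ< _

  toℕ-⊖ : ∀ a → toℕ (⊖ a) ≡ (n ∸ toℕ a) % n
  toℕ-⊖ a = toℕ-fromℕ< _

  toℕ-zeroₙ : toℕ (zeroₙ {n}) ≡ 0
  toℕ-zeroₙ = trans (toℕ-fromℕ< _) (m*n%n≡0 0 n)

  [m%n+k]%n≡[m+k]%n : ∀ m k → (m % n + k) % n ≡ (m + k) % n
  [m%n+k]%n≡[m+k]%n m k = begin
    (m % n + k) % n         ≡⟨ %-distribˡ-+ (m % n) k n ⟩
    (m % n % n + k % n) % n ≡⟨ cong (λ z → (z + k % n) % n) (m%n%n≡m%n m n) ⟩
    (m % n + k % n) % n     ≡⟨ %-distribˡ-+ m k n ⟨
    (m + k) % n             ∎
    where open ≡-Reasoning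

  [m+k%n]%n≡[m+k]%n : ∀ m k → (m + k % n) % n ≡ (m + k) % n
  [m+k%n]%n≡[m+k]%n m k = begin
    (m + k % n) % n ≡⟨ cong (_% n) (+-comm m (k % n)) ⟩
    (k % n + m) % n ≡⟨ [m%n+k]%n≡[m+k]%n k m ⟩
    (k + m) % n     ≡⟨ cong (_% n) (+-comm k m) ⟩
    (m + k) % n     ∎
    where open ≡-Reasoning

  ⊕-comm : ∀ a b → a ⊕ b ≡ b ⊕ a
  ⊕-comm a b = toℕ-injective (begin
    toℕ (a ⊕ b)           ≡⟨ toℕ-⊕ a b ⟩
    (toℕ a + toℕ b) % n   ≡⟨ cong (_% n) (+-comm (toℕ a) (toℕ b)) ⟩
    (toℕ b + toℕ a) % n   ≡⟨ toℕ-⊕ b a ⟨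
    toℕ (b ⊕ a)           ∎)
    where open ≡-Reasoning

  ⊕-assoc : ∀ a b c → (a ⊕ b) ⊕ c ≡ a ⊕ (b ⊕ c)
  ⊕-assoc a b c = toℕ-injective (begin
    toℕ ((a ⊕ b) ⊕ c)                    ≡⟨ toℕ-⊕ (a ⊕ b) c ⟩
    (toℕ (a ⊕ b) + toℕ c) % n            ≡⟨ cong (λ z → (z + toℕ c) % n) (toℕ-⊕ a b) ⟩
    ((toℕ a + toℕ b) % n + toℕ c) % n    ≡⟨ [m%n+k]%n≡[m+k]%n _ _ ⟩
    (toℕ a + toℕ b + toℕ c) % n          ≡⟨ cong (_% n) (+-assoc (toℕ a) _ _) ⟩
    (toℕ a + (toℕ b + toℕ c)) % n        ≡⟨ [m+k%n]%n≡[m+k]%n _ _ ⟨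
    (toℕ a + (toℕ b + toℕ c) % n) % n    ≡⟨ cong (λ z → (toℕ a + z) % n) (toℕ-⊕ b c) ⟨
    (toℕ a + toℕ (b ⊕ c)) % n            ≡⟨ toℕ-⊕ a (b ⊕ c) ⟨
    toℕ (a ⊕ (b ⊕ c))                    ∎)
    where open ≡-Reasoning

  ⊕-identityʳ : ∀ a → a ⊕ zeroₙ ≡ a
  ⊕-identityʳ a = toℕ-injective (begin
    toℕ (a ⊕ zeroₙ)              ≡⟨ toℕ-⊕ a zeroₙ ⟩
    (toℕ a + toℕ (zeroₙ {n})) % n ≡⟨ cong (λ z → (toℕ a + z) % n) toℕ-zeroₙ ⟩
    (toℕ a + 0) % n              ≡⟨ cong (_% n) (+-identityʳ (toℕ a)) ⟩
    toℕ a % n                    ≡⟨ m<n⇒m%n≡m (toℕ<n a) ⟩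
    toℕ a                        ∎)
    where open ≡-Reasoning

  ⊕-inverseʳ : ∀ a → a ⊕ (⊖ a) ≡ zeroₙ
  ⊕-inverseʳ a = toℕ-injective (begin
    toℕ (a ⊕ (⊖ a))                ≡⟨ toℕ-⊕ a (⊖ a) ⟩
    (toℕ a + toℕ (⊖ a)) % n        ≡⟨ cong (λ z → (toℕ a + z) % n) (toℕ-⊖ a) ⟩
    (toℕ a + (n ∸ toℕ a) % n) % n  ≡⟨ [m+k%n]%n≡[m+k]%n _ _ ⟩
    (toℕ a + (n ∸ toℕ a)) % n      ≡⟨ cong (_% n) (m+[n∸m]≡n (toℕ≤n a)) ⟩
    n % n                          ≡⟨ n%n≡0 n ⟩
    0                              ≡⟨ toℕ-zeroₙ ⟨
    toℕ (zeroₙ {n})                ∎)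
    where open ≡-Reasoning

  ⊕-⊖-isAbelianGroup : IsAbelianGroup _≡_ (_⊕_ {n}) zeroₙ ⊖_
  ⊕-⊖-isAbelianGroup = record
    { isGroup = record
      { isMonoid = record
        { isSemigroup = record
          { isMagma = record { isEquivalence = isEquivalence ; ∙-cong = cong₂ _⊕_ }
          ; assoc = ⊕-assoc
          }
        ; identity = (λ a → trans (⊕-comm zeroₙ a) (⊕-identityʳ a)) , ⊕-identityʳ
        }
      ; inverse = (λ a → trans (⊕-comm (⊖ a) a) (⊕-inverseʳ a)) , ⊕-inverseʳ
      ; ⁻¹-cong = cong ⊖_
      }
    ; comm = ⊕-comm
    }

ℤₙ-abelianGroup : (n : ℕ) .{{_ : NonZero n}} → AbelianGroup _ _
ℤₙ-abelianGroup n = record { isAbelianGroup = ⊕-⊖-isAbelianGroup {n} }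

module _ {n : ℕ} .{{_ : NonZero n}} where

  open AbelianGroup (ℤₙ-abelianGroup n) using (assoc)
  open AbelianGroupProperties (ℤₙ-abelianGroup n) using (⁻¹-anti-homo‿-; //-rightDividesˡ)

  ⊖-⊝ : ∀ (a b : Fin n) → ⊖ (a ⊝ b) ≡ b ⊝ a
  ⊖-⊝ = ⁻¹-anti-homo‿-

  ⊝-⊕-⊝ : ∀ (x y z : Fin n) → (x ⊝ y) ⊕ (y ⊝ z) ≡ x ⊝ z
  ⊝-⊕-⊝ x y z = begin
    (x ⊝ y) ⊕ (y ⊝ z)  ≡⟨ assoc (x ⊝ y) y (⊖ z) ⟨
    ((x ⊝ y) ⊕ y) ⊝ z  ≡⟨ cong (_⊝ z) (//-rightDividesˡ y x) ⟩
    x ⊝ z              ∎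
    where open ≡-Reasoning

  ⊕-even : 2 ∣ n → ∀ (a b : Fin n) → IsEven a → IsEven b → IsEven (a ⊕ b)
  ⊕-even 2∣n a b 2∣a 2∣b = subst (2 ∣_) (sym (toℕ-⊕ a b)) (%-presˡ-∣ (∣m∣n⇒∣m+n 2∣a 2∣b) 2∣n)

  ⊝-odd-even : 2 ∣ n → ∀ (y x : Fin n) → ¬ IsEven y → IsEven x → ¬ IsEven (y ⊝ x)
  ⊝-odd-even 2∣n y x y-odd x-even y⊝x-even =
    y-odd (subst IsEven (//-rightDividesˡ x y) (⊕-even 2∣n (y ⊝ x) x y⊝x-even x-even))

module _ {n : ℕ} .{{_ : NonZero n}} {S : Subset n} where

  Adj-sym : IsConnectionSet n S → ∀ v w → Adj S v w → Adj S w v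
  Adj-sym (S-sym , _) v w v∼w = subst (_∈ S) (⊖-⊝ w v) (S-sym (w ⊝ v) v∼w)

  Adj-sym-⇔ : IsConnectionSet n S → ∀ v w → Adj S v w ⇔ Adj S w v
  Adj-sym-⇔ conn v w = mk⇔ (Adj-sym conn v w) (Adj-sym conn w v)

  Adj-odd-shift : 2 ∣ n → {H : Subset n} →
    (∀ s → s ∈ S → ¬ IsEven s → ∀ h → h ∈ H → (s ⊕ h) ∈ S) →
    ∀ x x′ y → IsEven x → ¬ IsEven y → (x ⊝ x′) ∈ H → Adj S x y → Adj S x′ y
  Adj-odd-shift 2∣n S+H⊆S x x′ y x-even y-odd h∈H x∼y =
    subst (_∈ S) (⊝-⊕-⊝ y x x′) (S+H⊆S (y ⊝ x) x∼y (⊝-odd-even 2∣n y x y-odd x-even) (x ⊝ x′) h∈H)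

  Adj-odd-invariant : 2 ∣ n → {H : Subset n} → IsSubgroupOf2ℤ n H →
    (∀ s → s ∈ S → ¬ IsEven s → ∀ h → h ∈ H → (s ⊕ h) ∈ S) →
    ∀ x x′ y → IsEven x → IsEven x′ → ¬ IsEven y → (x′ ⊝ x) ∈ H → Adj S x y ⇔ Adj S x′ y
  Adj-odd-invariant 2∣n (_ , _ , _ , H-inv) S+H⊆S x x′ y x-even x′-even y-odd h∈H = mk⇔
    (Adj-odd-shift 2∣n S+H⊆S x x′ y x-even y-odd (subst (_∈ _) (⊖-⊝ x′ x) (H-inv _ h∈H)))
    (Adj-odd-shift 2∣n S+H⊆S x′ x y x′-even y-odd h∈H)

module _ {A : Set} (f : A → A) where

  iterate-+ : ∀ x i k → iterate f x (i + k) ≡ iterate f (iterate f x i) k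
  iterate-+ x zero    k = refl
  iterate-+ x (suc i) k = iterate-+ (f x) i k

  iterate-injective : Injective _≡_ _≡_ f → ∀ i {x y} → iterate f x i ≡ iterate f y i → x ≡ y
  iterate-injective f-inj zero    eq = eq
  iterate-injective f-inj (suc i) eq = f-inj (iterate-injective f-inj i eq)

  iterate-preserves : (R : A → Set) → (∀ x → R x → R (f x)) → ∀ x k → R x → R (iterate f x k)
  iterate-preserves R pres x zero    Rx = Rx
  iterate-preserves R pres x (suc k) Rx = iterate-preserves R pres (f x) k (pres x Rx)

  -- Pigeonhole on the first m + 1 iterates gives f^i x = f^(i + d + 1) x; cancel f^i.
  iterate-periodic : ∀ {m} (ι : A → Fin m) → Injective _≡_ _≡_ ι → Injective _≡_ _≡_ f →
    ∀ x → Σ ℕ λ p → iterate f x (suc p) ≡ x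
  iterate-periodic {m} ι ι-inj f-inj x with pigeonhole (n<1+n m) (ι ∘ iterate f x ∘ toℕ)
  ... | i , j , i<j , ιfⁱ≡ιfʲ with m≤n⇒∃[o]m+o≡n i<j
  ... | d , i+1+d≡j = d , sym (iterate-injective f-inj (toℕ i) (begin
    iterate f x (toℕ i)                        ≡⟨ ι-inj ιfⁱ≡ιfʲ ⟩
    iterate f x (toℕ j)                        ≡⟨ cong (iterate f x) (sym i+1+d≡j) ⟩
    iterate f x (suc (toℕ i + d))              ≡⟨ cong (iterate f x ∘ suc) (+-comm (toℕ i) d) ⟩
    iterate f x (suc d + toℕ i)                ≡⟨ iterate-+ x (suc d) (toℕ i) ⟩
    iterate f (iterate f x (suc d)) (toℕ i)    ∎))
    where open ≡-Reasoning

  reflects-if-preserves : ∀ {m} (ι : A → Fin m) → Injective _≡_ _≡_ ι → Injective _≡_ _≡_ f →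
    (R : A → Set) → (∀ x → R x → R (f x)) → ∀ x → R (f x) → R x
  reflects-if-preserves ι ι-inj f-inj R pres x Rfx with iterate-periodic ι ι-inj f-inj x
  ... | p , fᵖ⁺¹x≡x = subst R fᵖ⁺¹x≡x (iterate-preserves R pres (f x) p Rfx)

module ExtendByIdentity {A : Set} {P : A → Set} (P? : ∀ x → Dec (P x)) (P-irr : ∀ {x} → Irrelevant (P x)) where

  extend : (Σ A P → Σ A P) → A → A
  extend f x with P? x
  ... | yes p = proj₁ (f (x , p))
  ... | no _  = x

  extend-∈ : ∀ f {x} (p : P x) → extend f x ≡ proj₁ (f (x , p))
  extend-∈ f {x} p rewrite dec-yes-irr (P? x) P-irr p = refl

  extend-∉ : ∀ f {x} → ¬ P x → extend f x ≡ x
  extend-∉ f {x} ¬p rewrite dec-no (P? x) ¬p = refl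

  extend-inverse : ∀ f g → (∀ y → f (g y) ≡ y) → ∀ x → extend f (extend g x) ≡ x
  extend-inverse f g f∘g≡id x with P? x
  ... | yes p = trans (extend-∈ f (proj₂ (g (x , p)))) (cong proj₁ (f∘g≡id (x , p)))
  ... | no ¬p = extend-∉ f ¬p

  extend-↔ : Σ A P ↔ Σ A P → A ↔ A
  extend-↔ π = mk↔ₛ′ (extend to) (extend from)
    (extend-inverse to from strictlyInverseˡ) (extend-inverse from to strictlyInverseʳ)
    where open Inverse π

sheetwise : {A : Set} → (Bool → A ↔ A) → (A × Bool) ↔ (A × Bool)
sheetwise π = mk↔ₛ′ (λ (v , i) → (Inverse.to (π i) v , i)) (λ (v , i) → (Inverse.from (π i) v , i))
  (λ (v , i) → cong (_, i) (Inverse.strictlyInverseˡ (π i) v))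
  (λ (v , i) → cong (_, i) (Inverse.strictlyInverseʳ (π i) v))

module Construction {n : ℕ} .{{_ : NonZero n}} (2∣n : 2 ∣ n)
    (S : Subset n) (conn : IsConnectionSet n S)
    (α β : Even n ↔ Even n) (H : Subset n) (H-subgroup : IsSubgroupOf2ℤ n H)
    (αβ-preserves : ∀ u v → Adj S (proj₁ u) (proj₁ v) →
      Adj S (proj₁ (Inverse.to α u)) (proj₁ (Inverse.to β v)))
    (S+H⊆S : ∀ s → s ∈ S → ¬ IsEven s → ∀ h → h ∈ H → (s ⊕ h) ∈ S)
    (αβ-in-H : ∀ v → ((proj₁ (Inverse.to α v) ⊝ proj₁ v) ∈ H) ×
               ((proj₁ (Inverse.to β v) ⊝ proj₁ v) ∈ H)) where

  open ExtendByIdentity (λ (x : Fin n) → 2 ∣? toℕ x) ∣-irrelevant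

  α̂ β̂ : Fin n → Fin n
  α̂ = extend (Inverse.to α)
  β̂ = extend (Inverse.to β)

  αβ-reflects : ∀ u v → Adj S (proj₁ (Inverse.to α u)) (proj₁ (Inverse.to β v)) → Adj S (proj₁ u) (proj₁ v)
  αβ-reflects u v = reflects-if-preserves (map (Inverse.to α) (Inverse.to β))
    (λ (u , v) → combine (proj₁ u) (proj₁ v)) ι-injective αβ-injective
    (λ (u , v) → Adj S (proj₁ u) (proj₁ v)) (λ (u , v) → αβ-preserves u v) (u , v)
    where
    Even-injective : Injective _≡_ _≡_ (proj₁ {B = IsEven {n}})
    Even-injective {x , p} {.x , q} refl = cong (x ,_) (∣-irrelevant p q)
    ι-injective : Injective _≡_ _≡_ (λ ((u , v) : Even n × Even n) → combine (proj₁ u) (proj₁ v))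
    ι-injective {u , v} {u′ , v′} eq with combine-injective (proj₁ u) (proj₁ v) (proj₁ u′) (proj₁ v′) eq
    ... | u≡u′ , v≡v′ = cong₂ _,_ (Even-injective u≡u′) (Even-injective v≡v′)
    αβ-injective : Injective _≡_ _≡_ (map (Inverse.to α) (Inverse.to β))
    αβ-injective {u , v} {u′ , v′} eq =
      cong₂ _,_ (Injection.injective (↔⇒↣ α) (cong proj₁ eq)) (Injection.injective (↔⇒↣ β) (cong proj₂ eq))

  Adj-α̂β̂ : ∀ v w → Adj S v w ⇔ Adj S (α̂ v) (β̂ w)
  Adj-α̂β̂ v w with 2 ∣? toℕ v | 2 ∣? toℕ w
  ... | yes v-even | yes w-even
    = mk⇔ (αβ-preserves (v , v-even) (w , w-even)) (αβ-reflects (v , v-even) (w , w-even))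
  ... | yes v-even | no w-odd
    = Adj-odd-invariant 2∣n H-subgroup S+H⊆S v _ w v-even (proj₂ (Inverse.to α (v , v-even))) w-odd
        (proj₁ (αβ-in-H (v , v-even)))
  ... | no v-odd | yes w-even
    = ⇔.trans (Adj-sym-⇔ conn v w) (⇔.trans
        (Adj-odd-invariant 2∣n H-subgroup S+H⊆S w _ v w-even (proj₂ (Inverse.to β (w , w-even))) v-odd
          (proj₂ (αβ-in-H (w , w-even))))
        (Adj-sym-⇔ conn _ v))
  ... | no v-odd | no w-odd
    = ⇔.refl

  sheet : Bool → Fin n ↔ Fin n
  sheet false = extend-↔ α
  sheet true  = extend-↔ β

  φ : (Fin n × Bool) ↔ (Fin n × Bool)
  φ = sheetwise sheet

  φ-aut : IsAut (AdjB S) φ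
  φ-aut (v , i) (w , j) = (λ (i≢j , v∼w) → i≢j , Equivalence.to (sheets i j i≢j) v∼w)
                        , (λ (i≢j , v∼w) → i≢j , Equivalence.from (sheets i j i≢j) v∼w)
    where
    sheets : ∀ i j → i ≢ j → Adj S v w ⇔ Adj S (Inverse.to (sheet i) v) (Inverse.to (sheet j) w)
    sheets false false i≢j = ⊥-elim (i≢j refl)
    sheets true  true  i≢j = ⊥-elim (i≢j refl)
    sheets false true  _   = Adj-α̂β̂ v w
    sheets true  false _   = ⇔.trans (Adj-sym-⇔ conn v w)
                              (⇔.trans (Adj-α̂β̂ w v) (Adj-sym-⇔ conn (α̂ w) (β̂ v)))

  φ-not-split : ¬ (∀ v → proj₁ (Inverse.to α v) ≡ proj₁ (Inverse.to β v)) → ¬ InAutX×S₂ S φ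
  φ-not-split α≢β (ψ , σ , _ , φ≡ψ×σ) = α≢β λ (v , v-even) → begin
    proj₁ (Inverse.to α (v , v-even))  ≡⟨ extend-∈ (Inverse.to α) v-even ⟨
    α̂ v                                ≡⟨ cong proj₁ (φ≡ψ×σ v false) ⟩
    Inverse.to ψ v                     ≡⟨ cong proj₁ (φ≡ψ×σ v true) ⟨
    β̂ v                                ≡⟨ extend-∈ (Inverse.to β) v-even ⟩
    proj₁ (Inverse.to β (v , v-even))  ∎
    where open ≡-Reasoning

proposition3p11 : (n : ℕ) .{{_ : NonZero n}} → 2 ∣ n →
    (S : Subset n) → IsConnectionSet n S →
    (α β : Even n ↔ Even n) → (H : Subset n) → IsSubgroupOf2ℤ n H →
    ¬ (∀ v → proj₁ (Inverse.to α v) ≡ proj₁ (Inverse.to β v)) →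
    (∀ u v → Adj S (proj₁ u) (proj₁ v) →
      Adj S (proj₁ (Inverse.to α u)) (proj₁ (Inverse.to β v))) →
    (∀ s → s ∈ S → ¬ IsEven s → ∀ h → h ∈ H → (s ⊕ h) ∈ S) →
    (∀ v → ((proj₁ (Inverse.to α v) ⊝ proj₁ v) ∈ H) ×
           ((proj₁ (Inverse.to β v) ⊝ proj₁ v) ∈ H)) →
    Unstable n S
proposition3p11 n 2∣n S conn α β H H-subgroup α≢β αβ-preserves S+H⊆S αβ-in-H =
  φ , φ-aut , φ-not-split α≢β
  where open Construction 2∣n S conn α β H H-subgroup αβ-preserves S+H⊆S αβ-in-H
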